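{- Let $(x,y,k)$ be a good triplet. Then there exist $p,q \in \mathbb{N}$ such that $$|H(q,p,x,y)| < 72 q^4 + 1,$$ and moreover $q < x^{1/6}$ and $p < x^{2/3}+1$.
   Context: Here $\mathbb{N}=\{1,2,3,\dots\}$. A triple $(x,y,k)$ is a good triplet if $x,y \in \mathbb{N}$, $k = x^3 - y^2 \in \mathbb{Z}$, and $0 < |k| < \sqrt{x}$. The polynomials are $B(q,p,x) = p^2 - q^2x$, $C(q,p,x,y) = p^3 - 3pq^2x + 2q^3y$, $F(q,p,x,y) = 4pC - 3B^2$, and $H(q,p,x,y) = 9FB - 8C^2$, where $B,C,F$ denote $B(q,p,x)$, $C(q,p,x,y)$, $F(q,p,x,y)$. -}

module Defs where

open import Data.Nat using (ℕ) renaming (_≤_ to _≤ℕ_)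
open import Data.Integer using (ℤ; +_; _+_; _-_; _*_; _^_; _<_; ∣_∣; 0ℤ)
open import Data.Product using (_×_)
open import Relation.Binary.PropositionalEquality using (_≡_)
open import Relation.Nullary using (¬_)

B : ℤ → ℤ → ℤ → ℤ
B q p x = p ^ 2 - q ^ 2 * x

C : ℤ → ℤ → ℤ → ℤ → ℤ
C q p x y = p ^ 3 - + 3 * p * q ^ 2 * x + + 2 * q ^ 3 * y

F : ℤ → ℤ → ℤ → ℤ → ℤ
F q p x y = + 4 * p * C q p x y - + 3 * B q p x ^ 2

H : ℤ → ℤ → ℤ → ℤ → ℤ
H q p x y = + 9 * F q p x y * B q p x - + 8 * C q p x y ^ 2

-- (x, y, k) is a good triplet: x, y ∈ ℕ = {1,2,...}, k = x^3 - y^2,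
-- and 0 < |k| < √x, the latter written as |k|^2 < x (both sides nonnegative).
record GoodTriplet (x y : ℕ) (k : ℤ) : Set where
  field
    x-pos   : 1 ≤ℕ x
    y-pos   : 1 ≤ℕ y
    k-def   : k ≡ (+ x) ^ 3 - (+ y) ^ 2
    k-nz    : ¬ (k ≡ 0ℤ)
    k-small : + (∣ k ∣ Data.Nat.* ∣ k ∣) < + x

{-# OPTIONS --safe #-}

-- Put D = p x − q y and k = x³ − y².  As x²B, x³C and x p are polynomials in q, y, k and D,
-- so is x⁶H, and reducing y² = x³ − k leaves ten monomials in q, x³, y, k, D.  Choose N
-- with N⁶ < x ≤ (N + 1)⁶ and, by Dirichlet's theorem, 1 ≤ q ≤ N with (N + 1)|D| ≤ x.
-- Since |k|² < x and y² ≤ x³ + |k|, the monomial 72q⁵x³ykD times N + 1 is at most 72q⁵x⁶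
-- and the other nine together at most (36q + 34)x⁶; as q < N + 1 this gives
-- x⁶|H| < (72q⁴ + 1)x⁶.  Finally (p − 1)x < q y yields
-- (p − 1)⁶x⁶ < q⁶y⁶ ≤ (x − 1)(x³ + x)³ < x¹⁰.

module Submission where

open import Defs

module Polynomials where

  open import Data.Nat as ℕ using (ℕ)
  import Data.Nat.Properties as ℕ
  open import Data.Integer using (ℤ; +_; _+_; _-_; _*_; _^_; ∣_∣)
  open import Data.Integer.Properties
    using (∣i+j∣≤∣i∣+∣j∣; ∣i*j∣≡∣i∣*∣j∣; ∣-i∣≡∣i∣; pos-*; [+m]-[+n]≡m⊖n; ∣m⊖n∣≡∣n⊖m∣; ∣⊖∣-≤)
  open import Data.Integer.Solver using (module +-*-Solver)
  open +-*-Solver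
    using (Polynomial; op; [+]; [*]; con; var; _:+_; _:-_; _:*_; _:^_; :-_; ⟦_⟧; solve; _:=_)
  open import Data.Fin using (zero; suc)
  open import Data.Sum using (inj₁; inj₂)
  open import Data.Vec using (Vec; []; _∷_; lookup; map)
  open import Data.Vec.Properties using (lookup-map)
  open import Relation.Binary.PropositionalEquality
    using (_≡_; refl; sym; trans; cong; cong₂; module ≡-Reasoning)

  pos-^ : ∀ m n → + (m ℕ.^ n) ≡ (+ m) ^ n
  pos-^ m ℕ.zero    = refl
  pos-^ m (ℕ.suc n) = trans (pos-* m (m ℕ.^ n)) (cong (+ m *_) (pos-^ m n))

  ∣[+m]-[+n]∣≡∣m-n∣ : ∀ m n → ∣ + m - + n ∣ ≡ ℕ.∣ m - n ∣
  ∣[+m]-[+n]∣≡∣m-n∣ m n rewrite [+m]-[+n]≡m⊖n m n with ℕ.≤-total m n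
  ... | inj₁ m≤n = trans (∣⊖∣-≤ m≤n) (sym (ℕ.m≤n⇒∣m-n∣≡n∸m m≤n))
  ... | inj₂ n≤m = trans (∣m⊖n∣≡∣n⊖m∣ m n) (trans (∣⊖∣-≤ n≤m) (sym (ℕ.m≤n⇒∣n-m∣≡n∸m n≤m)))

  majorant : ∀ {n} → Polynomial n → Vec ℕ n → ℕ
  majorant (op [+] p q) ρ = majorant p ρ ℕ.+ majorant q ρ
  majorant (op [*] p q) ρ = majorant p ρ ℕ.* majorant q ρ
  majorant (con c)      ρ = ∣ c ∣
  majorant (var i)      ρ = lookup ρ i
  majorant (p :^ k)     ρ = majorant p ρ ℕ.^ k
  majorant (:- p)       ρ = majorant p ρ

  ∣⟦p⟧∣≤majorant : ∀ {n} (p : Polynomial n) (ρ : Vec ℤ n) → ∣ ⟦ p ⟧ ρ ∣ ℕ.≤ majorant p (map ∣_∣ ρ)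
  ∣⟦p⟧∣≤majorant (op [+] p q) ρ =
    ℕ.≤-trans (∣i+j∣≤∣i∣+∣j∣ (⟦ p ⟧ ρ) (⟦ q ⟧ ρ)) (ℕ.+-mono-≤ (∣⟦p⟧∣≤majorant p ρ) (∣⟦p⟧∣≤majorant q ρ))
  ∣⟦p⟧∣≤majorant (op [*] p q) ρ rewrite ∣i*j∣≡∣i∣*∣j∣ (⟦ p ⟧ ρ) (⟦ q ⟧ ρ) =
    ℕ.*-mono-≤ (∣⟦p⟧∣≤majorant p ρ) (∣⟦p⟧∣≤majorant q ρ)
  ∣⟦p⟧∣≤majorant (con c)      ρ = ℕ.≤-refl
  ∣⟦p⟧∣≤majorant (var i)      ρ rewrite lookup-map i ∣_∣ ρ = ℕ.≤-refl
  ∣⟦p⟧∣≤majorant (p :^ k)     ρ = power k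
    where
    power : ∀ k → ∣ ⟦ p :^ k ⟧ ρ ∣ ℕ.≤ majorant p (map ∣_∣ ρ) ℕ.^ k
    power ℕ.zero    = ℕ.≤-refl
    power (ℕ.suc k) rewrite ∣i*j∣≡∣i∣*∣j∣ (⟦ p ⟧ ρ) (⟦ p :^ k ⟧ ρ) =
      ℕ.*-mono-≤ (∣⟦p⟧∣≤majorant p ρ) (power k)
  ∣⟦p⟧∣≤majorant (:- p)       ρ rewrite ∣-i∣≡∣i∣ (⟦ p ⟧ ρ) = ∣⟦p⟧∣≤majorant p ρ

  -- H q p x y unfolds to Ĥ p (B q p x) (C q p x y).
  Ĥ : ℤ → ℤ → ℤ → ℤ
  Ĥ u b c = + 9 * (+ 4 * u * c - + 3 * b ^ 2) * b - + 8 * c ^ 2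

  Ĥ-homogeneous : ∀ t u b c → t ^ 6 * Ĥ u b c ≡ Ĥ (t * u) (t ^ 2 * b) (t ^ 3 * c)
  Ĥ-homogeneous = solve 4 (λ t u b c →
    let Ĥ′ u b c = con (+ 9) :* (con (+ 4) :* u :* c :- con (+ 3) :* b :^ 2) :* b :- con (+ 8) :* c :^ 2
    in t :^ 6 :* Ĥ′ u b c := Ĥ′ (t :* u) (t :^ 2 :* b) (t :^ 3 :* c)) refl

  x²B≡ : ∀ p q x y → let D = p * x - q * y ; k = x ^ 3 - y ^ 2 in
    x ^ 2 * B q p x ≡ D ^ 2 + + 2 * q * y * D - q ^ 2 * k
  x²B≡ = solve 4 (λ p q x y → let D = p :* x :- q :* y ; k = x :^ 3 :- y :^ 2 in
    x :^ 2 :* (p :^ 2 :- q :^ 2 :* x) := D :^ 2 :+ con (+ 2) :* q :* y :* D :- q :^ 2 :* k) refl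

  x³C≡ : ∀ p q x y → let D = p * x - q * y ; k = x ^ 3 - y ^ 2 in
    x ^ 3 * C q p x y ≡ D ^ 3 + + 3 * q * y * D ^ 2 - + 3 * q ^ 2 * k * D - q ^ 3 * y * k
  x³C≡ = solve 4 (λ p q x y → let D = p :* x :- q :* y ; k = x :^ 3 :- y :^ 2 in
    x :^ 3 :* (p :^ 3 :- con (+ 3) :* p :* q :^ 2 :* x :+ con (+ 2) :* q :^ 3 :* y)
      := D :^ 3 :+ con (+ 3) :* q :* y :* D :^ 2 :- con (+ 3) :* q :^ 2 :* k :* D :- q :^ 3 :* y :* k) refl

  expansion : ∀ {n} (q X y k D : Polynomial n) → Polynomial n
  expansion q X y k D =
      D :^ 6 :+ con (+ 6) :* q :* y :* D :^ 5 :- con (+ 15) :* q :^ 2 :* k :* D :^ 4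
    :- con (+ 20) :* q :^ 3 :* y :* k :* D :^ 3 :+ con (+ 15) :* q :^ 4 :* k :^ 2 :* D :^ 2
    :- con (+ 60) :* q :^ 4 :* X :* k :* D :^ 2 :+ con (+ 6) :* q :^ 5 :* y :* k :^ 2 :* D
    :- con (+ 72) :* q :^ 5 :* X :* y :* k :* D :- q :^ 6 :* k :^ 3
    :+ con (+ 28) :* q :^ 6 :* X :* k :^ 2

  -- The variables stand for q, x³, y, k = x³ − y² and D = p x − q y.
  H-expansion : Polynomial 5
  H-expansion = expansion (var zero) (var (suc zero)) (var (suc (suc zero)))
                          (var (suc (suc (suc zero)))) (var (suc (suc (suc (suc zero)))))

  Ĥ-expansion : ∀ D q y k →
    Ĥ (D + q * y) (D ^ 2 + + 2 * q * y * D - q ^ 2 * k)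
      (D ^ 3 + + 3 * q * y * D ^ 2 - + 3 * q ^ 2 * k * D - q ^ 3 * y * k)
    ≡ ⟦ H-expansion ⟧ (q ∷ y ^ 2 + k ∷ y ∷ k ∷ D ∷ [])
  Ĥ-expansion = solve 4 (λ D q y k →
    let Ĥ′ u b c = con (+ 9) :* (con (+ 4) :* u :* c :- con (+ 3) :* b :^ 2) :* b :- con (+ 8) :* c :^ 2
    in Ĥ′ (D :+ q :* y) (D :^ 2 :+ con (+ 2) :* q :* y :* D :- q :^ 2 :* k)
         (D :^ 3 :+ con (+ 3) :* q :* y :* D :^ 2 :- con (+ 3) :* q :^ 2 :* k :* D :- q :^ 3 :* y :* k)
       := expansion q (y :^ 2 :+ k) y k D) refl

  x⁶H≡expansion : ∀ p q x y →
    x ^ 6 * H q p x y ≡ ⟦ H-expansion ⟧ (q ∷ x ^ 3 ∷ y ∷ x ^ 3 - y ^ 2 ∷ p * x - q * y ∷ [])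
  x⁶H≡expansion p q x y = begin
    x ^ 6 * Ĥ p (B q p x) (C q p x y)                ≡⟨ Ĥ-homogeneous x p (B q p x) (C q p x y) ⟩
    Ĥ (x * p) (x ^ 2 * B q p x) (x ^ 3 * C q p x y)  ≡⟨ cong₂ (Ĥ (x * p)) (x²B≡ p q x y) (x³C≡ p q x y) ⟩
    Ĥ (x * p) b c                                    ≡⟨ cong (λ u → Ĥ u b c) xp≡D+qy ⟩
    Ĥ (D + q * y) b c                                ≡⟨ Ĥ-expansion D q y k ⟩
    ⟦ H-expansion ⟧ (q ∷ y ^ 2 + k ∷ y ∷ k ∷ D ∷ [])
      ≡⟨ cong (λ X → ⟦ H-expansion ⟧ (q ∷ X ∷ y ∷ k ∷ D ∷ [])) y²+k≡x³ ⟩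
    ⟦ H-expansion ⟧ (q ∷ x ^ 3 ∷ y ∷ k ∷ D ∷ [])     ∎
    where
    open ≡-Reasoning
    D = p * x - q * y
    k = x ^ 3 - y ^ 2
    b = D ^ 2 + + 2 * q * y * D - q ^ 2 * k
    c = D ^ 3 + + 3 * q * y * D ^ 2 - + 3 * q ^ 2 * k * D - q ^ 3 * y * k
    xp≡D+qy : x * p ≡ D + q * y
    xp≡D+qy = solve 4 (λ p q x y → x :* p := (p :* x :- q :* y) :+ q :* y) refl p q x y
    y²+k≡x³ : y ^ 2 + k ≡ x ^ 3
    y²+k≡x³ = solve 2 (λ x y → y :^ 2 :+ (x :^ 3 :- y :^ 2) := x :^ 3) refl x y

  x⁶∣H∣≤majorant : ∀ p q x y →
    x ℕ.^ 6 ℕ.* ∣ H (+ q) (+ p) (+ x) (+ y) ∣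
      ℕ.≤ majorant H-expansion (q ∷ x ℕ.^ 3 ∷ y ∷ ∣ (+ x) ^ 3 - (+ y) ^ 2 ∣ ∷ ℕ.∣ p ℕ.* x - q ℕ.* y ∣ ∷ [])
  x⁶∣H∣≤majorant p q x y = begin
    x ℕ.^ 6 ℕ.* ∣ H′ ∣          ≡⟨ cong (ℕ._* ∣ H′ ∣) (cong ∣_∣ (pos-^ x 6)) ⟩
    ∣ (+ x) ^ 6 ∣ ℕ.* ∣ H′ ∣    ≡⟨ sym (∣i*j∣≡∣i∣*∣j∣ ((+ x) ^ 6) H′) ⟩
    ∣ (+ x) ^ 6 * H′ ∣          ≡⟨ cong ∣_∣ (x⁶H≡expansion (+ p) (+ q) (+ x) (+ y)) ⟩
    ∣ ⟦ H-expansion ⟧ ρ ∣       ≤⟨ ∣⟦p⟧∣≤majorant H-expansion ρ ⟩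
    majorant H-expansion (map ∣_∣ ρ)
      ≡⟨ cong₂ (λ X T → majorant H-expansion (q ∷ X ∷ y ∷ ∣ (+ x) ^ 3 - (+ y) ^ 2 ∣ ∷ T ∷ []))
               (cong ∣_∣ (sym (pos-^ x 3)))
               (trans (cong₂ (λ a b → ∣ a - b ∣) (sym (pos-* p x)) (sym (pos-* q y)))
                      (∣[+m]-[+n]∣≡∣m-n∣ (p ℕ.* x) (q ℕ.* y))) ⟩
    majorant H-expansion (q ∷ x ℕ.^ 3 ∷ y ∷ ∣ (+ x) ^ 3 - (+ y) ^ 2 ∣ ∷ ℕ.∣ p ℕ.* x - q ℕ.* y ∣ ∷ []) ∎
    where
    open ℕ.≤-Reasoning
    H′ = H (+ q) (+ p) (+ x) (+ y)
    ρ = + q ∷ (+ x) ^ 3 ∷ + y ∷ (+ x) ^ 3 - (+ y) ^ 2 ∷ + p * + x - + q * + y ∷ []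

module Estimates where

  open import Data.Nat
  open import Data.Nat.Properties
  open import Data.Nat.DivMod
    using (_/_; _%_; m≡m%n+[m/n]*n; m%n<n; m/n*n≤m; /-monoˡ-≤; m<n*o⇒m/o<n; m*n%n≡0; 0/n≡0)
  open import Data.Nat.Solver using (module +-*-Solver)
  open +-*-Solver using (solve; _:=_; con; _:+_; _:*_; _:^_)
  open import Data.Integer as ℤ using (ℤ; +_; ∣_∣)
  open import Data.Integer.Properties using (drop‿+<+; ∣i∣≡0⇒i≡0)
  open import Data.Fin using (toℕ; fromℕ<)
  open import Data.Fin.Properties using (pigeonhole; toℕ-fromℕ<; toℕ<n)
  open import Data.Product using (∃-syntax; ∃₂; _×_; _,_)
  open import Data.Sum using (inj₁; inj₂)
  open import Data.Vec using ([]; _∷_)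
  open import Relation.Nullary using (yes; no; contradiction)
  open import Relation.Nullary.Decidable using (True; toWitness)
  open import Relation.Binary.PropositionalEquality
  open Polynomials using (majorant; H-expansion; x⁶∣H∣≤majorant; pos-^; ∣[+m]-[+n]∣≡∣m-n∣)

  m≤m^[1+n] : ∀ m n → m ≤ m ^ suc n
  m≤m^[1+n] zero      n = z≤n
  m≤m^[1+n] m@(suc _) n = m≤m*n m (m ^ n) {{m^n≢0 m n}}

  ^-cancelˡ-< : ∀ n {m o} → m ^ n < o ^ n → m < o
  ^-cancelˡ-< n m^n<o^n = ≰⇒> (λ o≤m → <⇒≱ m^n<o^n (^-monoˡ-≤ n o≤m))

  ^-cancelˡ-≤ : ∀ n .{{_ : NonZero n}} {m o} → m ^ n ≤ o ^ n → m ≤ o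
  ^-cancelˡ-≤ n m^n≤o^n = ≮⇒≥ (λ o<m → <⇒≱ (^-monoˡ-< n o<m) m^n≤o^n)

  m*n≤o⇒n<o : ∀ {m n o} → 1 < m → 0 < o → m * n ≤ o → n < o
  m*n≤o⇒n<o {n = zero}      _   0<o _    = 0<o
  m*n≤o⇒n<o {m} {n = suc n} 1<m _   mn≤o =
    <-≤-trans (m<m*n (suc n) m 1<m) (≤-trans (≤-reflexive (*-comm (suc n) m)) mn≤o)

  m/o≡n/o⇒∣m-n∣<o : ∀ m n o .{{_ : NonZero o}} → m / o ≡ n / o → ∣ m - n ∣ < o
  m/o≡n/o⇒∣m-n∣<o m n o eq = begin-strict
    ∣ m - n ∣                                  ≡⟨ cong₂ ∣_-_∣ (m≡m%n+[m/n]*n m o) (m≡m%n+[m/n]*n n o) ⟩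
    ∣ m % o + m / o * o - n % o + n / o * o ∣  ≡⟨ cong (λ t → ∣ m % o + m / o * o - n % o + t * o ∣) (sym eq) ⟩
    ∣ m % o + m / o * o - n % o + m / o * o ∣  ≡⟨ ∣m+o-n+o∣≡∣m-n∣ (m % o) (n % o) (m / o * o) ⟩
    ∣ m % o - n % o ∣                          ≤⟨ ∣m-n∣≤m⊔n (m % o) (n % o) ⟩
    m % o ⊔ n % o                              <⟨ ⊔-pres-<m (m%n<n m o) (m%n<n n o) ⟩
    o                                          ∎
    where
    open ≤-Reasoning
    ∣m+o-n+o∣≡∣m-n∣ : ∀ m n o → ∣ m + o - n + o ∣ ≡ ∣ m - n ∣
    ∣m+o-n+o∣≡∣m-n∣ m n o rewrite +-comm m o | +-comm n o = ∣m+n-m+o∣≡∣n-o∣ o m n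

  m+o≡n+p⇒∣m-n∣≡∣p-o∣ : ∀ m n o p → m + o ≡ n + p → ∣ m - n ∣ ≡ ∣ p - o ∣
  m+o≡n+p⇒∣m-n∣≡∣p-o∣ m n o p eq = begin
    ∣ m - n ∣          ≡⟨ sym (∣m+n-m+o∣≡∣n-o∣ o m n) ⟩
    ∣ o + m - o + n ∣  ≡⟨ cong₂ ∣_-_∣ (trans (+-comm o m) eq) (+-comm o n) ⟩
    ∣ n + p - n + o ∣  ≡⟨ ∣m+n-m+o∣≡∣n-o∣ n p o ⟩
    ∣ p - o ∣          ∎
    where open ≡-Reasoning

  root-bracket : ∀ n x → 1 ≤ x → ∃[ N ] N ^ suc n < x × x ≤ suc N ^ suc n
  root-bracket n x 1≤x = search x (≤-trans (n≤1+n x) (m≤m^[1+n] (suc x) n))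
    where
    search : ∀ m → x ≤ suc m ^ suc n → ∃[ N ] N ^ suc n < x × x ≤ suc N ^ suc n
    search zero    x≤1 = 0 , 1≤x , x≤1
    search (suc m) x≤[2+m]^[1+n] with x ≤? suc m ^ suc n
    ... | yes x≤[1+m]^[1+n] = search m x≤[1+m]^[1+n]
    ... | no  x≰[1+m]^[1+n] = suc m , ≰⇒> x≰[1+m]^[1+n] , x≤[2+m]^[1+n]

  module _ (N x y : ℕ) .{{_ : NonZero N}} .{{_ : NonZero x}} where

    private
      M = suc N

      r : ℕ → ℕ
      r i = i * y % x

      a : ℕ → ℕ
      a i = i * y / x

      iy≡r+ax : ∀ i → i * y ≡ r i + a i * x
      iy≡r+ax i = m≡m%n+[m/n]*n (i * y) x

      -- The M + 1 points r 0, …, r N and x (at index M, the fractional part 1) go into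
      -- the M bins [j x / M, (j + 1) x / M); the point x is put in the top bin N.
      bin : ℕ → ℕ
      bin i with i <? M
      ... | yes _ = M * r i / x
      ... | no  _ = N

      bin<M : ∀ i → bin i < M
      bin<M i with i <? M
      ... | yes _ = m<n*o⇒m/o<n (*-monoʳ-< M (m%n<n (i * y) x))
      ... | no  _ = ≤-refl

      bin-< : ∀ {i} → i < M → bin i ≡ M * r i / x
      bin-< {i} i<M with i <? M
      ... | yes _   = refl
      ... | no  i≮M = contradiction i<M i≮M

      bin-M : bin M ≡ N
      bin-M with M <? M
      ... | yes M<M = contradiction M<M (<-irrefl refl)
      ... | no  _   = refl

      Approximation : Set
      Approximation = ∃₂ λ q p → 1 ≤ q × q ≤ N × M * ∣ p * x - q * y ∣ ≤ x

      same-bin : ∀ i j → i < j → j < M → M * r i / x ≡ M * r j / x → Approximation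
      same-bin i j i<j j<M eq = q , p , m<n⇒0<n∸m i<j , ≤-trans (m∸n≤m j i) (s≤s⁻¹ j<M) , bound
        where
        q = j ∸ i
        p = a j ∸ a i
        px+rj≡qy+ri : p * x + r j ≡ q * y + r i
        px+rj≡qy+ri = +-cancelˡ-≡ (a i * x) _ _ (begin
          a i * x + (p * x + r j)  ≡⟨ solve 4 (λ A P X R → A :* X :+ (P :* X :+ R) := R :+ (A :+ P) :* X)
                                              refl (a i) p x (r j) ⟩
          r j + (a i + p) * x      ≡⟨ cong (λ t → r j + t * x) (m+[n∸m]≡n (/-monoˡ-≤ x (*-monoˡ-≤ y (<⇒≤ i<j)))) ⟩
          r j + a j * x            ≡⟨ sym (iy≡r+ax j) ⟩
          j * y                    ≡⟨ cong (_* y) (sym (m+[n∸m]≡n (<⇒≤ i<j))) ⟩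
          (i + q) * y              ≡⟨ *-distribʳ-+ y i q ⟩
          i * y + q * y            ≡⟨ cong (_+ q * y) (iy≡r+ax i) ⟩
          r i + a i * x + q * y    ≡⟨ solve 4 (λ R A X Q → R :+ A :* X :+ Q := A :* X :+ (Q :+ R))
                                              refl (r i) (a i) x (q * y) ⟩
          a i * x + (q * y + r i)  ∎)
          where open ≡-Reasoning
        bound : M * ∣ p * x - q * y ∣ ≤ x
        bound = begin
          M * ∣ p * x - q * y ∣  ≡⟨ cong (M *_) (m+o≡n+p⇒∣m-n∣≡∣p-o∣ (p * x) (q * y) (r j) (r i) px+rj≡qy+ri) ⟩
          M * ∣ r i - r j ∣      ≡⟨ *-distribˡ-∣-∣ M (r i) (r j) ⟩
          ∣ M * r i - M * r j ∣  ≤⟨ <⇒≤ (m/o≡n/o⇒∣m-n∣<o (M * r i) (M * r j) x eq) ⟩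
          x                      ∎
          where open ≤-Reasoning

      top-bin : ∀ i → i < M → M * r i / x ≡ N → Approximation
      top-bin zero _ eq = contradiction (trans (sym eq) bin₀≡0) (≢-nonZero⁻¹ N)
        where
        bin₀≡0 : M * r 0 / x ≡ 0
        bin₀≡0 = trans (cong (λ t → M * t / x) (m*n%n≡0 0 x)) (trans (cong (_/ x) (*-zeroʳ M)) (0/n≡0 x))
      top-bin i@(suc _) i<M eq = i , p , s≤s z≤n , s≤s⁻¹ i<M , bound
        where
        p = suc (a i)
        px+ri≡iy+x : p * x + r i ≡ i * y + x
        px+ri≡iy+x = begin
          p * x + r i        ≡⟨ solve 3 (λ X A R → (X :+ A :* X) :+ R := (R :+ A :* X) :+ X) refl x (a i) (r i) ⟩
          r i + a i * x + x  ≡⟨ cong (_+ x) (sym (iy≡r+ax i)) ⟩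
          i * y + x          ∎
          where open ≡-Reasoning
        Nx≤Mri : N * x ≤ M * r i
        Nx≤Mri = subst (λ t → t * x ≤ M * r i) eq (m/n*n≤m (M * r i) x)
        bound : M * ∣ p * x - i * y ∣ ≤ x
        bound = begin
          M * ∣ p * x - i * y ∣  ≡⟨ cong (M *_) (m+o≡n+p⇒∣m-n∣≡∣p-o∣ (p * x) (i * y) (r i) x px+ri≡iy+x) ⟩
          M * ∣ x - r i ∣        ≡⟨ cong (M *_) (m≤n⇒∣n-m∣≡n∸m (<⇒≤ (m%n<n (i * y) x))) ⟩
          M * (x ∸ r i)          ≡⟨ *-distribˡ-∸ M x (r i) ⟩
          M * x ∸ M * r i        ≤⟨ ∸-monoʳ-≤ (M * x) Nx≤Mri ⟩
          x + N * x ∸ N * x      ≡⟨ m+n∸n≡m x (N * x) ⟩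
          x                      ∎
          where open ≤-Reasoning

      approximation-from-bins : ∀ i j → i < j → j ≤ M → bin i ≡ bin j → Approximation
      approximation-from-bins i j i<j j≤M eq with m≤n⇒m<n∨m≡n j≤M
      ... | inj₁ j<M  = same-bin i j i<j j<M (trans (sym (bin-< (<-trans i<j j<M))) (trans eq (bin-< j<M)))
      ... | inj₂ refl = top-bin i i<j (trans (sym (bin-< i<j)) (trans eq bin-M))

    dirichlet : ∃₂ λ q p → 1 ≤ q × q ≤ N × suc N * ∣ p * x - q * y ∣ ≤ x
    dirichlet with pigeonhole ≤-refl (λ i → fromℕ< (bin<M (toℕ i)))
    ... | i , j , i<j , fi≡fj = approximation-from-bins (toℕ i) (toℕ j) i<j (s≤s⁻¹ (toℕ<n j))
      (trans (sym (toℕ-fromℕ< (bin<M (toℕ i)))) (trans (cong toℕ fi≡fj) (toℕ-fromℕ< (bin<M (toℕ j)))))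

  2n≤1+n² : ∀ n → 2 * n ≤ suc (n ^ 2)
  2n≤1+n² zero    = z≤n
  2n≤1+n² (suc n) = subst (2 * suc n ≤_)
    (solve 1 (λ n → con 2 :* (con 1 :+ n) :+ n :^ 2 := con 1 :+ (con 1 :+ n) :^ 2) refl n)
    (m≤m+n (2 * suc n) (n ^ 2))

  m≤2+n⇒m*u*v≤n³ : ∀ {m u v n} → m ≤ 2 + n → u < n → v < n → m * u * v ≤ n ^ 3
  m≤2+n⇒m*u*v≤n³ {m} {u} {v} {suc w} m≤2+n (s≤s u≤w) (s≤s v≤w) = begin
    m * u * v                      ≤⟨ *-mono-≤ (*-mono-≤ m≤2+n u≤w) v≤w ⟩
    (3 + w) * w * w                ≤⟨ m≤m+n _ (3 * w + 1) ⟩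
    (3 + w) * w * w + (3 * w + 1)  ≡⟨ solve 1 (λ w → (con 3 :+ w) :* w :* w :+ (con 3 :* w :+ con 1) := (con 1 :+ w) :^ 3)
                                              refl w ⟩
    suc w ^ 3                      ∎
    where open ≤-Reasoning

  72q⁵+36q+34<M[72q⁴+1] : ∀ {q M} → 1 ≤ q → q < M → 72 * q ^ 5 + 36 * q + 34 < M * (72 * q ^ 4 + 1)
  72q⁵+36q+34<M[72q⁴+1] {suc r} {M} _ q<M = begin-strict
    72 * suc r ^ 5 + 36 * suc r + 34
      <⟨ m<m+n _ (s≤s z≤n) ⟩
    72 * suc r ^ 5 + 36 * suc r + 34 + (4 + 253 * r + 432 * r ^ 2 + 288 * r ^ 3 + 72 * r ^ 4)
      ≡⟨ solve 1 (λ r → con 72 :* (con 1 :+ r) :^ 5 :+ con 36 :* (con 1 :+ r) :+ con 34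
                        :+ (con 4 :+ con 253 :* r :+ con 432 :* r :^ 2 :+ con 288 :* r :^ 3 :+ con 72 :* r :^ 4)
                      := (con 2 :+ r) :* (con 72 :* (con 1 :+ r) :^ 4 :+ con 1)) refl r ⟩
    suc (suc r) * (72 * suc r ^ 4 + 1)
      ≤⟨ *-monoˡ-≤ (72 * suc r ^ 4 + 1) q<M ⟩
    M * (72 * suc r ^ 4 + 1) ∎
    where open ≤-Reasoning

  n[[1+n]²+1]³<[1+n]⁷ : ∀ n → n * (suc n ^ 2 + 1) ^ 3 < suc n ^ 7
  n[[1+n]²+1]³<[1+n]⁷ zero    = s≤s z≤n
  n[[1+n]²+1]³<[1+n]⁷ (suc n) = begin-strict
    suc n * (suc (suc n) ^ 2 + 1) ^ 3
      <⟨ m<m+n _ (s≤s z≤n) ⟩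
    suc n * (suc (suc n) ^ 2 + 1) ^ 3 + (3 + 23 * n + 57 * n ^ 2 + 61 * n ^ 3 + 33 * n ^ 4 + 9 * n ^ 5 + n ^ 6)
      ≡⟨ solve 1 (λ n → (con 1 :+ n) :* ((con 2 :+ n) :^ 2 :+ con 1) :^ 3
                        :+ (con 3 :+ con 23 :* n :+ con 57 :* n :^ 2 :+ con 61 :* n :^ 3
                            :+ con 33 :* n :^ 4 :+ con 9 :* n :^ 5 :+ n :^ 6)
                      := (con 2 :+ n) :^ 7) refl n ⟩
    suc (suc n) ^ 7 ∎
    where open ≤-Reasoning

  module MajorantBound {N q x y K T : ℕ} (1≤q : 1 ≤ q) (q≤N : q ≤ N) (N⁶<x : N ^ 6 < x)
    (x≤M⁶ : x ≤ suc N ^ 6) (K²<x : K ^ 2 < x) (y²≤x³+K : y ^ 2 ≤ x ^ 3 + K) (MT≤x : suc N * T ≤ x) where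

    open ≤-Reasoning

    private
      M = suc N

      instance
        q≢0 : NonZero q
        q≢0 = >-nonZero 1≤q
        N≢0 : NonZero N
        N≢0 = >-nonZero (≤-trans 1≤q q≤N)

      2≤M : 2 ≤ M
      2≤M = s≤s (≤-trans 1≤q q≤N)

      q⁶<x : q ^ 6 < x
      q⁶<x = ≤-<-trans (^-monoˡ-≤ 6 q≤N) N⁶<x

      2≤x : 2 ≤ x
      2≤x = ≤-trans (s≤s (^-monoˡ-≤ 6 (≤-trans 1≤q q≤N))) N⁶<x

      instance
        x≢0 : NonZero x
        x≢0 = >-nonZero (≤-trans (s≤s z≤n) 2≤x)

      q^≤x : ∀ j {j≤6 : True (j ≤? 6)} → q ^ j ≤ x
      q^≤x j {j≤6} = ≤-trans (^-monoʳ-≤ q (toWitness j≤6)) (<⇒≤ q⁶<x)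

      x^≤x⁶ : ∀ j {j≤6 : True (j ≤? 6)} → x ^ j ≤ x ^ 6
      x^≤x⁶ j {j≤6} = ^-monoʳ-≤ x (toWitness j≤6)

      K≤x : K ≤ x
      K≤x = ≤-trans (m≤m^[1+n] K 1) (<⇒≤ K²<x)

      T≤x : T ≤ x
      T≤x = ≤-trans (m≤n*m T M) MT≤x

      M≤x : M ≤ x
      M≤x = ≤-<-trans (m≤m^[1+n] N 5) N⁶<x

      MT^≤x^ : ∀ j → (M * T) ^ j ≤ x ^ j
      MT^≤x^ j = ^-monoˡ-≤ j MT≤x

      yK≤x² : y * K ≤ x ^ 2
      yK≤x² = ^-cancelˡ-≤ 2 (begin
        (y * K) ^ 2            ≡⟨ solve 2 (λ y K → (y :* K) :^ 2 := y :^ 2 :* K :^ 2) refl y K ⟩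
        y ^ 2 * K ^ 2          ≤⟨ *-monoˡ-≤ (K ^ 2) y²≤x³+K ⟩
        (x ^ 3 + K) * K ^ 2    ≡⟨ solve 2 (λ x K → (x :^ 3 :+ K) :* K :^ 2 := x :^ 3 :* K :^ 2 :+ K :^ 3) refl x K ⟩
        x ^ 3 * K ^ 2 + K ^ 3  ≤⟨ +-monoʳ-≤ (x ^ 3 * K ^ 2) (^-monoˡ-≤ 3 K≤x) ⟩
        x ^ 3 * K ^ 2 + x ^ 3  ≡⟨ solve 2 (λ x K → x :^ 3 :* K :^ 2 :+ x :^ 3 := x :^ 3 :* (con 1 :+ K :^ 2)) refl x K ⟩
        x ^ 3 * suc (K ^ 2)    ≤⟨ *-monoʳ-≤ (x ^ 3) K²<x ⟩
        x ^ 3 * x              ≡⟨ solve 1 (λ x → x :^ 3 :* x := (x :^ 2) :^ 2) refl x ⟩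
        (x ^ 2) ^ 2            ∎)

      My≤M⁵x : M * y ≤ M ^ 5 * x
      My≤M⁵x = ^-cancelˡ-≤ 2 (begin
        (M * y) ^ 2                      ≡⟨ solve 2 (λ M y → (M :* y) :^ 2 := M :^ 2 :* y :^ 2) refl M y ⟩
        M ^ 2 * y ^ 2                    ≤⟨ *-monoʳ-≤ (M ^ 2) (≤-trans y²≤x³+K (+-monoʳ-≤ (x ^ 3) K≤x³)) ⟩
        M ^ 2 * (x ^ 3 + x ^ 3)          ≡⟨ solve 2 (λ M x → M :^ 2 :* (x :^ 3 :+ x :^ 3) := con 2 :* M :^ 2 :* x :^ 3)
                                                    refl M x ⟩
        2 * M ^ 2 * x ^ 3                ≤⟨ *-mono-≤ (*-monoˡ-≤ (M ^ 2) 2≤M²) (*-monoˡ-≤ (x ^ 2) x≤M⁶) ⟩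
        M ^ 2 * M ^ 2 * (M ^ 6 * x ^ 2)  ≡⟨ solve 2 (λ M x → M :^ 2 :* M :^ 2 :* (M :^ 6 :* x :^ 2) := (M :^ 5 :* x) :^ 2)
                                                    refl M x ⟩
        (M ^ 5 * x) ^ 2                  ∎)
        where
        K≤x³ = ≤-trans K≤x (m≤m^[1+n] x 2)
        2≤M² = ≤-trans 2≤M (m≤m^[1+n] M 1)

    bound-T⁶ : M * T ^ 6 ≤ x ^ 6
    bound-T⁶ = begin
      M * T ^ 6        ≡⟨ solve 2 (λ M T → M :* T :^ 6 := (M :* T) :* T :^ 5) refl M T ⟩
      (M * T) * T ^ 5  ≤⟨ *-mono-≤ MT≤x (^-monoˡ-≤ 5 T≤x) ⟩
      x ^ 6            ∎

    bound-qyT⁵ : M * (6 * q * y * T ^ 5) ≤ 6 * q * x ^ 6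
    bound-qyT⁵ = *-cancelˡ-≤ (M ^ 5) (begin
      M ^ 5 * (M * (6 * q * y * T ^ 5))
        ≡⟨ solve 4 (λ M q y T → M :^ 5 :* (M :* (con 6 :* q :* y :* T :^ 5))
                              := con 6 :* q :* (M :* y) :* (M :* T) :^ 5) refl M q y T ⟩
      6 * q * (M * y) * (M * T) ^ 5
        ≤⟨ *-mono-≤ (*-monoʳ-≤ (6 * q) My≤M⁵x) (MT^≤x^ 5) ⟩
      6 * q * (M ^ 5 * x) * x ^ 5
        ≡⟨ solve 3 (λ M q x → con 6 :* q :* (M :^ 5 :* x) :* x :^ 5 := M :^ 5 :* (con 6 :* q :* x :^ 6)) refl M q x ⟩
      M ^ 5 * (6 * q * x ^ 6) ∎)
      where instance _ = m^n≢0 M 5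

    bound-q²KT⁴ : M * (15 * q ^ 2 * K * T ^ 4) ≤ 2 * x ^ 6
    bound-q²KT⁴ = *-cancelˡ-≤ (M ^ 3) (begin
      M ^ 3 * (M * (15 * q ^ 2 * K * T ^ 4))
        ≡⟨ solve 4 (λ M q K T → M :^ 3 :* (M :* (con 15 :* q :^ 2 :* K :* T :^ 4))
                              := con 15 :* (q :^ 2 :* K) :* (M :* T) :^ 4) refl M q K T ⟩
      15 * (q ^ 2 * K) * (M * T) ^ 4
        ≤⟨ *-mono-≤ (*-monoʳ-≤ 15 (*-mono-≤ (q^≤x 2) K≤x)) (MT^≤x^ 4) ⟩
      15 * (x * x) * x ^ 4
        ≡⟨ solve 1 (λ x → con 15 :* (x :* x) :* x :^ 4 := con 15 :* x :^ 6) refl x ⟩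
      15 * x ^ 6
        ≤⟨ *-monoˡ-≤ (x ^ 6) (≤-trans (n≤1+n 15) (*-monoˡ-≤ 2 (^-monoˡ-≤ 3 2≤M))) ⟩
      M ^ 3 * 2 * x ^ 6
        ≡⟨ *-assoc (M ^ 3) 2 (x ^ 6) ⟩
      M ^ 3 * (2 * x ^ 6) ∎)
      where instance _ = m^n≢0 M 3

    bound-q³yKT³ : M * (20 * q ^ 3 * y * K * T ^ 3) ≤ 5 * x ^ 6
    bound-q³yKT³ = *-cancelˡ-≤ (M ^ 2) (begin
      M ^ 2 * (M * (20 * q ^ 3 * y * K * T ^ 3))
        ≡⟨ solve 5 (λ M q y K T → M :^ 2 :* (M :* (con 20 :* q :^ 3 :* y :* K :* T :^ 3))
                                := con 20 :* q :^ 3 :* (y :* K) :* (M :* T) :^ 3) refl M q y K T ⟩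
      20 * q ^ 3 * (y * K) * (M * T) ^ 3
        ≤⟨ *-mono-≤ (*-mono-≤ (*-monoʳ-≤ 20 (q^≤x 3)) yK≤x²) (MT^≤x^ 3) ⟩
      20 * x * x ^ 2 * x ^ 3
        ≡⟨ solve 1 (λ x → con 20 :* x :* x :^ 2 :* x :^ 3 := con 20 :* x :^ 6) refl x ⟩
      20 * x ^ 6
        ≤⟨ *-monoˡ-≤ (x ^ 6) (*-monoˡ-≤ 5 (^-monoˡ-≤ 2 2≤M)) ⟩
      M ^ 2 * 5 * x ^ 6
        ≡⟨ *-assoc (M ^ 2) 5 (x ^ 6) ⟩
      M ^ 2 * (5 * x ^ 6) ∎)
      where instance _ = m^n≢0 M 2

    bound-q⁴K²T² : M * (15 * q ^ 4 * K ^ 2 * T ^ 2) ≤ 8 * x ^ 6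
    bound-q⁴K²T² = *-cancelˡ-≤ M (begin
      M * (M * (15 * q ^ 4 * K ^ 2 * T ^ 2))
        ≡⟨ solve 4 (λ M q K T → M :* (M :* (con 15 :* q :^ 4 :* K :^ 2 :* T :^ 2))
                              := con 15 :* q :^ 4 :* K :^ 2 :* (M :* T) :^ 2) refl M q K T ⟩
      15 * q ^ 4 * K ^ 2 * (M * T) ^ 2
        ≤⟨ *-mono-≤ (*-mono-≤ (*-monoʳ-≤ 15 (q^≤x 4)) (<⇒≤ K²<x)) (MT^≤x^ 2) ⟩
      15 * x * x * x ^ 2
        ≡⟨ solve 1 (λ x → con 15 :* x :* x :* x :^ 2 := con 15 :* x :^ 4) refl x ⟩
      15 * x ^ 4
        ≤⟨ *-mono-≤ (≤-trans (n≤1+n 15) (*-monoʳ-≤ 8 2≤M)) (x^≤x⁶ 4) ⟩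
      8 * M * x ^ 6
        ≡⟨ solve 2 (λ M x → con 8 :* M :* x :^ 6 := M :* (con 8 :* x :^ 6)) refl M x ⟩
      M * (8 * x ^ 6) ∎)

    bound-q⁴x³KT² : M * (60 * q ^ 4 * x ^ 3 * K * T ^ 2) ≤ 30 * q * x ^ 6
    bound-q⁴x³KT² = *-cancelˡ-≤ M (begin
      M * (M * (60 * q ^ 4 * x ^ 3 * K * T ^ 2))
        ≡⟨ solve 5 (λ M q x K T → M :* (M :* (con 60 :* q :^ 4 :* x :^ 3 :* K :* T :^ 2))
                                := con 60 :* q :* (q :^ 3 :* K) :* x :^ 3 :* (M :* T) :^ 2) refl M q x K T ⟩
      60 * q * (q ^ 3 * K) * x ^ 3 * (M * T) ^ 2
        ≤⟨ *-mono-≤ (*-monoˡ-≤ (x ^ 3) (*-monoʳ-≤ (60 * q) q³K≤x)) (MT^≤x^ 2) ⟩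
      60 * q * x * x ^ 3 * x ^ 2
        ≡⟨ solve 2 (λ q x → con 60 :* q :* x :* x :^ 3 :* x :^ 2 := con 2 :* (con 30 :* q :* x :^ 6)) refl q x ⟩
      2 * (30 * q * x ^ 6)
        ≤⟨ *-monoˡ-≤ (30 * q * x ^ 6) 2≤M ⟩
      M * (30 * q * x ^ 6) ∎)
      where
      q³K≤x : q ^ 3 * K ≤ x
      q³K≤x = <⇒≤ (^-cancelˡ-< 2 (begin-strict
        (q ^ 3 * K) ^ 2  ≡⟨ solve 2 (λ q K → (q :^ 3 :* K) :^ 2 := q :^ 6 :* K :^ 2) refl q K ⟩
        q ^ 6 * K ^ 2    <⟨ *-mono-< q⁶<x K²<x ⟩
        x * x            ≡⟨ solve 1 (λ x → x :* x := x :^ 2) refl x ⟩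
        x ^ 2            ∎))

    bound-q⁵yK²T : M * (6 * q ^ 5 * y * K ^ 2 * T) ≤ 3 * x ^ 6
    bound-q⁵yK²T = begin
      M * (6 * q ^ 5 * y * K ^ 2 * T)
        ≡⟨ solve 5 (λ M q y K T → M :* (con 6 :* q :^ 5 :* y :* K :^ 2 :* T)
                                := con 6 :* q :^ 5 :* (y :* K) :* K :* (M :* T)) refl M q y K T ⟩
      6 * q ^ 5 * (y * K) * K * (M * T)
        ≤⟨ *-mono-≤ (*-mono-≤ (*-mono-≤ (*-monoʳ-≤ 6 (q^≤x 5)) yK≤x²) K≤x) MT≤x ⟩
      6 * x * x ^ 2 * x * x
        ≡⟨ solve 1 (λ x → con 6 :* x :* x :^ 2 :* x :* x := con 3 :* (con 2 :* x :^ 5)) refl x ⟩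
      3 * (2 * x ^ 5)
        ≤⟨ *-monoʳ-≤ 3 (*-monoˡ-≤ (x ^ 5) 2≤x) ⟩
      3 * x ^ 6 ∎

    bound-q⁵x³yKT : M * (72 * q ^ 5 * x ^ 3 * y * K * T) ≤ 72 * q ^ 5 * x ^ 6
    bound-q⁵x³yKT = begin
      M * (72 * q ^ 5 * x ^ 3 * y * K * T)
        ≡⟨ solve 6 (λ M q x y K T → M :* (con 72 :* q :^ 5 :* x :^ 3 :* y :* K :* T)
                                  := con 72 :* q :^ 5 :* x :^ 3 :* (y :* K) :* (M :* T)) refl M q x y K T ⟩
      72 * q ^ 5 * x ^ 3 * (y * K) * (M * T)
        ≤⟨ *-mono-≤ (*-monoʳ-≤ (72 * q ^ 5 * x ^ 3) yK≤x²) MT≤x ⟩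
      72 * q ^ 5 * x ^ 3 * x ^ 2 * x
        ≡⟨ solve 2 (λ q x → con 72 :* q :^ 5 :* x :^ 3 :* x :^ 2 :* x := con 72 :* q :^ 5 :* x :^ 6) refl q x ⟩
      72 * q ^ 5 * x ^ 6 ∎

    bound-q⁶K³ : M * (q ^ 6 * K ^ 3) ≤ x ^ 6
    bound-q⁶K³ = begin
      M * (q ^ 6 * K ^ 3)  ≤⟨ *-mono-≤ M≤x (*-mono-≤ (<⇒≤ q⁶<x) (^-monoˡ-≤ 3 K≤x)) ⟩
      x * (x * x ^ 3)      ≡⟨ solve 1 (λ x → x :* (x :* x :^ 3) := x :^ 5) refl x ⟩
      x ^ 5                ≤⟨ x^≤x⁶ 5 ⟩
      x ^ 6                ∎

    bound-q⁶x³K² : M * (28 * q ^ 6 * x ^ 3 * K ^ 2) ≤ 14 * x ^ 6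
    bound-q⁶x³K² = begin
      M * (28 * q ^ 6 * x ^ 3 * K ^ 2)
        ≡⟨ solve 4 (λ M q x K → M :* (con 28 :* q :^ 6 :* x :^ 3 :* K :^ 2)
                              := con 14 :* (con 2 :* M :* q :^ 6 :* K :^ 2) :* x :^ 3) refl M q x K ⟩
      14 * (2 * M * q ^ 6 * K ^ 2) * x ^ 3
        ≤⟨ *-monoˡ-≤ (x ^ 3) (*-monoʳ-≤ 14 (m≤2+n⇒m*u*v≤n³ 2M≤2+x q⁶<x K²<x)) ⟩
      14 * x ^ 3 * x ^ 3
        ≡⟨ solve 1 (λ x → con 14 :* x :^ 3 :* x :^ 3 := con 14 :* x :^ 6) refl x ⟩
      14 * x ^ 6 ∎
      where
      2N≤x : 2 * N ≤ x
      2N≤x = ≤-trans (2n≤1+n² N) (≤-trans (s≤s (^-monoʳ-≤ N {2} {6} (s≤s (s≤s z≤n)))) N⁶<x)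
      2M≤2+x : 2 * M ≤ 2 + x
      2M≤2+x = subst (_≤ 2 + x) (sym (*-suc 2 N)) (+-monoʳ-≤ 2 2N≤x)

    M*majorant≤ : M * (T ^ 6 + 6 * q * y * T ^ 5 + 15 * q ^ 2 * K * T ^ 4 + 20 * q ^ 3 * y * K * T ^ 3
                       + 15 * q ^ 4 * K ^ 2 * T ^ 2 + 60 * q ^ 4 * x ^ 3 * K * T ^ 2 + 6 * q ^ 5 * y * K ^ 2 * T
                       + 72 * q ^ 5 * x ^ 3 * y * K * T + q ^ 6 * K ^ 3 + 28 * q ^ 6 * x ^ 3 * K ^ 2)
                  ≤ (72 * q ^ 5 + 36 * q + 34) * x ^ 6
    M*majorant≤ = begin
      M * (t₁ + t₂ + t₃ + t₄ + t₅ + t₆ + t₇ + t₈ + t₉ + t₁₀)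
        ≡⟨ solve 11 (λ M t₁ t₂ t₃ t₄ t₅ t₆ t₇ t₈ t₉ t₁₀ →
                       M :* (t₁ :+ t₂ :+ t₃ :+ t₄ :+ t₅ :+ t₆ :+ t₇ :+ t₈ :+ t₉ :+ t₁₀)
                    := M :* t₁ :+ M :* t₂ :+ M :* t₃ :+ M :* t₄ :+ M :* t₅
                       :+ M :* t₆ :+ M :* t₇ :+ M :* t₈ :+ M :* t₉ :+ M :* t₁₀)
                    refl M t₁ t₂ t₃ t₄ t₅ t₆ t₇ t₈ t₉ t₁₀ ⟩
      M * t₁ + M * t₂ + M * t₃ + M * t₄ + M * t₅ + M * t₆ + M * t₇ + M * t₈ + M * t₉ + M * t₁₀
        ≤⟨ +-mono-≤ (+-mono-≤ (+-mono-≤ (+-mono-≤ (+-mono-≤ (+-mono-≤ (+-mono-≤ (+-mono-≤ (+-mono-≤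
             bound-T⁶ bound-qyT⁵) bound-q²KT⁴) bound-q³yKT³) bound-q⁴K²T²) bound-q⁴x³KT²) bound-q⁵yK²T)
             bound-q⁵x³yKT) bound-q⁶K³) bound-q⁶x³K² ⟩
      X + 6 * q * X + 2 * X + 5 * X + 8 * X + 30 * q * X + 3 * X + 72 * q ^ 5 * X + X + 14 * X
        ≡⟨ solve 2 (λ q X → X :+ con 6 :* q :* X :+ con 2 :* X :+ con 5 :* X :+ con 8 :* X :+ con 30 :* q :* X
                           :+ con 3 :* X :+ con 72 :* q :^ 5 :* X :+ X :+ con 14 :* X
                           := (con 72 :* q :^ 5 :+ con 36 :* q :+ con 34) :* X) refl q X ⟩
      (72 * q ^ 5 + 36 * q + 34) * X ∎
      where
      X = x ^ 6
      t₁ = T ^ 6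
      t₂ = 6 * q * y * T ^ 5
      t₃ = 15 * q ^ 2 * K * T ^ 4
      t₄ = 20 * q ^ 3 * y * K * T ^ 3
      t₅ = 15 * q ^ 4 * K ^ 2 * T ^ 2
      t₆ = 60 * q ^ 4 * x ^ 3 * K * T ^ 2
      t₇ = 6 * q ^ 5 * y * K ^ 2 * T
      t₈ = 72 * q ^ 5 * x ^ 3 * y * K * T
      t₉ = q ^ 6 * K ^ 3
      t₁₀ = 28 * q ^ 6 * x ^ 3 * K ^ 2

    majorant< : T ^ 6 + 6 * q * y * T ^ 5 + 15 * q ^ 2 * K * T ^ 4 + 20 * q ^ 3 * y * K * T ^ 3
                + 15 * q ^ 4 * K ^ 2 * T ^ 2 + 60 * q ^ 4 * x ^ 3 * K * T ^ 2 + 6 * q ^ 5 * y * K ^ 2 * T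
                + 72 * q ^ 5 * x ^ 3 * y * K * T + q ^ 6 * K ^ 3 + 28 * q ^ 6 * x ^ 3 * K ^ 2
                < (72 * q ^ 4 + 1) * x ^ 6
    majorant< = *-cancelˡ-< M _ _ (begin-strict
      M * _                              ≤⟨ M*majorant≤ ⟩
      (72 * q ^ 5 + 36 * q + 34) * x ^ 6 <⟨ *-monoˡ-< (x ^ 6) (72q⁵+36q+34<M[72q⁴+1] 1≤q (s≤s q≤N)) ⟩
      M * (72 * q ^ 4 + 1) * x ^ 6       ≡⟨ *-assoc M (72 * q ^ 4 + 1) (x ^ 6) ⟩
      M * ((72 * q ^ 4 + 1) * x ^ 6)     ∎)
      where instance _ = m^n≢0 x 6

  Px<qy⇒P³<x² : ∀ {P q x y K} → P * x < q * y → q ^ 6 < x → y ^ 2 ≤ x ^ 3 + K → K ≤ x → P ^ 3 < x ^ 2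
  Px<qy⇒P³<x² {P} {q} {suc w} {y} {K} Px<qy (s≤s q⁶≤w) y²≤x³+K K≤x =
    ^-cancelˡ-< 2 (*-cancelʳ-< (x ^ 6) _ _ (begin-strict
      (P ^ 3) ^ 2 * x ^ 6             ≡⟨ solve 2 (λ P x → (P :^ 3) :^ 2 :* x :^ 6 := (P :* x) :^ 6) refl P x ⟩
      (P * x) ^ 6                     <⟨ ^-monoˡ-< 6 Px<qy ⟩
      (q * y) ^ 6                     ≡⟨ solve 2 (λ q y → (q :* y) :^ 6 := q :^ 6 :* (y :^ 2) :^ 3) refl q y ⟩
      q ^ 6 * (y ^ 2) ^ 3             ≤⟨ *-mono-≤ q⁶≤w (^-monoˡ-≤ 3 (≤-trans y²≤x³+K (+-monoʳ-≤ (x ^ 3) K≤x))) ⟩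
      w * (x ^ 3 + x) ^ 3             ≡⟨ solve 2 (λ w x → w :* (x :^ 3 :+ x) :^ 3 := w :* (x :^ 2 :+ con 1) :^ 3 :* x :^ 3)
                                                  refl w x ⟩
      w * (x ^ 2 + 1) ^ 3 * x ^ 3     <⟨ *-monoˡ-< (x ^ 3) (n[[1+n]²+1]³<[1+n]⁷ w) ⟩
      x ^ 7 * x ^ 3                   ≡⟨ solve 1 (λ x → x :^ 7 :* x :^ 3 := (x :^ 2) :^ 2 :* x :^ 6) refl x ⟩
      (x ^ 2) ^ 2 * x ^ 6             ∎))
    where
    open ≤-Reasoning
    x = suc w

  module _ {x y : ℕ} {k : ℤ} (good : GoodTriplet x y k) where

    open GoodTriplet good
    open ≤-Reasoning

    ∣k∣≡∣x³-y²∣ : ∣ k ∣ ≡ ∣ x ^ 3 - y ^ 2 ∣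
    ∣k∣≡∣x³-y²∣ = trans (cong ∣_∣ k-def)
      (trans (cong₂ (λ a b → ∣ a ℤ.- b ∣) (sym (pos-^ x 3)) (sym (pos-^ y 2)))
             (∣[+m]-[+n]∣≡∣m-n∣ (x ^ 3) (y ^ 2)))

    1≤∣k∣ : 1 ≤ ∣ k ∣
    1≤∣k∣ = n≢0⇒n>0 (λ ∣k∣≡0 → k-nz (∣i∣≡0⇒i≡0 ∣k∣≡0))

    ∣k∣²<x : ∣ k ∣ ^ 2 < x
    ∣k∣²<x = subst (_< x) (cong (∣ k ∣ *_) (sym (*-identityʳ ∣ k ∣))) (drop‿+<+ k-small)

    ∣k∣<x : ∣ k ∣ < x
    ∣k∣<x = ≤-<-trans (m≤m^[1+n] ∣ k ∣ 1) ∣k∣²<x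

    2≤x : 2 ≤ x
    2≤x = ≤-<-trans 1≤∣k∣ ∣k∣<x

    y²≤x³+∣k∣ : y ^ 2 ≤ x ^ 3 + ∣ k ∣
    y²≤x³+∣k∣ = subst (λ K → y ^ 2 ≤ x ^ 3 + K) (sym ∣k∣≡∣x³-y²∣) (m≤n+∣n-m∣ (y ^ 2) (x ^ 3))

    x³≤y²+∣k∣ : x ^ 3 ≤ y ^ 2 + ∣ k ∣
    x³≤y²+∣k∣ = subst (λ K → x ^ 3 ≤ y ^ 2 + K) (sym ∣k∣≡∣x³-y²∣) (m≤n+∣m-n∣ (x ^ 3) (y ^ 2))

    x<y : x < y
    x<y = ≰⇒> λ y≤x → <⇒≱ (begin-strict
      y ^ 2 + ∣ k ∣  <⟨ +-mono-≤-< (^-monoˡ-≤ 2 y≤x) ∣k∣<x ⟩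
      x ^ 2 + x      ≤⟨ +-monoʳ-≤ (x ^ 2) (m≤m^[1+n] x 1) ⟩
      x ^ 2 + x ^ 2  ≡⟨ solve 1 (λ x → x :^ 2 :+ x :^ 2 := con 2 :* x :^ 2) refl x ⟩
      2 * x ^ 2      ≤⟨ *-monoˡ-≤ (x ^ 2) 2≤x ⟩
      x ^ 3          ∎) x³≤y²+∣k∣

    private instance
      x≢0 : NonZero x
      x≢0 = >-nonZero (≤-trans (s≤s z≤n) 2≤x)

    x≤[1+N]⁶⇒1≤N : ∀ {N} → x ≤ suc N ^ 6 → 1 ≤ N
    x≤[1+N]⁶⇒1≤N {zero}  x≤1 = contradiction x≤1 (<⇒≱ 2≤x)
    x≤[1+N]⁶⇒1≤N {suc N} _   = s≤s z≤n

    module Approximant {N q p : ℕ} (1≤q : 1 ≤ q) (q≤N : q ≤ N) (N⁶<x : N ^ 6 < x)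
             (x≤[1+N]⁶ : x ≤ suc N ^ 6) ([1+N]T≤x : suc N * ∣ p * x - q * y ∣ ≤ x) where

      private
        T = ∣ p * x - q * y ∣

        instance
          q≢0 : NonZero q
          q≢0 = >-nonZero 1≤q

      q⁶<x : q ^ 6 < x
      q⁶<x = ≤-<-trans (^-monoˡ-≤ 6 q≤N) N⁶<x

      ∣H∣<72q⁴+1 : ∣ H (+ q) (+ p) (+ x) (+ y) ∣ < 72 * q ^ 4 + 1
      ∣H∣<72q⁴+1 = *-cancelˡ-< (x ^ 6) _ _ (begin-strict
        x ^ 6 * ∣ H (+ q) (+ p) (+ x) (+ y) ∣
          ≤⟨ x⁶∣H∣≤majorant p q x y ⟩
        majorant H-expansion (q ∷ x ^ 3 ∷ y ∷ ∣ (+ x) ℤ.^ 3 ℤ.- (+ y) ℤ.^ 2 ∣ ∷ T ∷ [])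
          ≡⟨ cong (λ k → majorant H-expansion (q ∷ x ^ 3 ∷ y ∷ ∣ k ∣ ∷ T ∷ [])) (sym k-def) ⟩
        majorant H-expansion (q ∷ x ^ 3 ∷ y ∷ ∣ k ∣ ∷ T ∷ [])
          <⟨ MajorantBound.majorant< 1≤q q≤N N⁶<x x≤[1+N]⁶ ∣k∣²<x y²≤x³+∣k∣ [1+N]T≤x ⟩
        (72 * q ^ 4 + 1) * x ^ 6
          ≡⟨ *-comm (72 * q ^ 4 + 1) (x ^ 6) ⟩
        x ^ 6 * (72 * q ^ 4 + 1) ∎)

      1≤p : 1 ≤ p
      1≤p = n≢0⇒n>0 λ p≡0 → <⇒≱ x<y (begin
        y                  ≤⟨ m≤n*m y q ⟩
        q * y              ≤⟨ m≤n*m (q * y) (suc N) ⟩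
        suc N * (q * y)    ≤⟨ subst (λ p → suc N * ∣ p * x - q * y ∣ ≤ x) p≡0 [1+N]T≤x ⟩
        x                  ∎)

      [p∸1]³<x² : (p ∸ 1) ^ 3 < x ^ 2
      [p∸1]³<x² = Px<qy⇒P³<x² {P = p ∸ 1} {q} {y = y} Px<qy q⁶<x y²≤x³+∣k∣ (<⇒≤ ∣k∣<x)
        where
        T<x : T < x
        T<x = m*n≤o⇒n<o (s≤s (≤-trans 1≤q q≤N)) (≤-trans (s≤s z≤n) 2≤x) [1+N]T≤x
        Px<qy : (p ∸ 1) * x < q * y
        Px<qy = +-cancelʳ-< x _ _ (begin-strict
          (p ∸ 1) * x + x  ≡⟨ +-comm ((p ∸ 1) * x) x ⟩
          suc (p ∸ 1) * x  ≡⟨ cong (_* x) (m+[n∸m]≡n 1≤p) ⟩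
          p * x            ≤⟨ m≤n+∣m-n∣ (p * x) (q * y) ⟩
          q * y + T        <⟨ +-monoʳ-< (q * y) T<x ⟩
          q * y + x        ∎)

    good-approximation : ∃₂ λ p q → 1 ≤ p × 1 ≤ q × ∣ H (+ q) (+ p) (+ x) (+ y) ∣ < 72 * q ^ 4 + 1
                                   × q ^ 6 < x × (p ∸ 1) ^ 3 < x ^ 2
    good-approximation with root-bracket 5 x (≤-trans (s≤s z≤n) 2≤x)
    ... | N , N⁶<x , x≤[1+N]⁶
        with dirichlet N x y {{>-nonZero (x≤[1+N]⁶⇒1≤N x≤[1+N]⁶)}}
    ... | q , p , 1≤q , q≤N , [1+N]T≤x =
      p , q , 1≤p , 1≤q , ∣H∣<72q⁴+1 , q⁶<x , [p∸1]³<x²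
      where open Approximant {p = p} 1≤q q≤N N⁶<x x≤[1+N]⁶ [1+N]T≤x

open import Data.Nat using (ℕ; _≤_; _∸_)
import Data.Nat as ℕ
open import Data.Integer using (ℤ; +_; _+_; _-_; _*_; _^_; _<_; ∣_∣; +<+)
open import Data.Integer.Properties using (pos-+; pos-*; [+m]-[+n]≡m⊖n; ⊖-≥)
open import Data.Product using (Σ; _×_; _,_)
open import Relation.Binary.PropositionalEquality using (_≡_; sym; trans; cong; subst; subst₂)
open Polynomials using (pos-^)
open Estimates using (good-approximation)

proposition5p5 : (x y : ℕ) (k : ℤ) → GoodTriplet x y k →
    Σ ℕ λ p → Σ ℕ λ q → (1 ≤ p) × (1 ≤ q) ×
      (+ ∣ H (+ q) (+ p) (+ x) (+ y) ∣ < + 72 * (+ q) ^ 4 + + 1) ×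
      ((+ q) ^ 6 < + x) ×
      ((+ p Data.Integer.- + 1) ^ 3 < (+ x) ^ 2)
proposition5p5 x y k good =
  let p , q , 1≤p , 1≤q , ∣H∣< , q⁶<x , [p∸1]³<x² = good-approximation good
  in p , q , 1≤p , 1≤q
   , subst (+ ∣ H (+ q) (+ p) (+ x) (+ y) ∣ <_) (72q⁴+1-cast q) (+<+ ∣H∣<)
   , subst (_< + x) (pos-^ q 6) (+<+ q⁶<x)
   , subst₂ _<_ (p∸1-cast p 1≤p) (pos-^ x 2) (+<+ [p∸1]³<x²)
  where
  72q⁴+1-cast : ∀ q → + (72 ℕ.* q ℕ.^ 4 ℕ.+ 1) ≡ + 72 * (+ q) ^ 4 + + 1
  72q⁴+1-cast q =
    trans (pos-+ (72 ℕ.* q ℕ.^ 4) 1) (cong (_+ + 1) (trans (pos-* 72 (q ℕ.^ 4)) (cong (+ 72 *_) (pos-^ q 4))))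
  p∸1-cast : ∀ p → 1 ≤ p → + ((p ∸ 1) ℕ.^ 3) ≡ (+ p - + 1) ^ 3
  p∸1-cast p 1≤p = trans (pos-^ (p ∸ 1) 3) (cong (_^ 3) (sym (trans ([+m]-[+n]≡m⊖n p 1) (⊖-≥ 1≤p))))
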